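{- For any graphs $G$ and $H$, $\varpi(G\oplus H)\ge \varpi(G)\varpi(H)$.
   Context: All graphs are finite and simple. Two vertices $x,y$ are true twins if $N_G[x]=N_G[y]$. A twins-free clique is a clique $X$ such that $N_G[u]\ne N_G[v]$ for all distinct $u,v\in X$; the twins-free clique number $\varpi(G)$ is the maximum cardinality of a twins-free clique. The Cartesian sum $G\oplus H$ of $G=(V_1,E_1)$ and $H=(V_2,E_2)$ has vertex set $V_1\times V_2$, with $(a,b)(c,d)$ an edge iff $ac\in E_1$ or $bd\in E_2$. -}

module Defs where

open import Data.Nat using (ℕ; _*_; _≤_)
open import Data.Fin using (Fin; remQuot; _≟_)
open import Data.Fin.Subset using (Subset; _∈_; ∣_∣)
open import Data.Bool using (Bool; true; false; _∨_)
open import Data.Product using (_×_; _,_; proj₁; proj₂; Σ)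
open import Relation.Binary.PropositionalEquality using (_≡_; _≢_)
open import Relation.Nullary using (¬_)
open import Relation.Nullary.Decidable using (⌊_⌋)

Adj : ℕ → Set
Adj n = Fin n → Fin n → Bool

IsSimple : ∀ {n} → Adj n → Set
IsSimple {n} G = (∀ (u v : Fin n) → G u v ≡ G v u) × (∀ (u : Fin n) → G u u ≡ false)

N[_] : ∀ {n} → Adj n → Fin n → Fin n → Bool
N[ G ] u w = ⌊ u ≟ w ⌋ ∨ G u w

TrueTwins : ∀ {n} → Adj n → Fin n → Fin n → Set
TrueTwins {n} G u v = ∀ (w : Fin n) → N[ G ] u w ≡ N[ G ] v w

IsClique : ∀ {n} → Adj n → Subset n → Set
IsClique {n} G X = ∀ (u v : Fin n) → u ∈ X → v ∈ X → u ≢ v → G u v ≡ true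

IsTwinsFreeClique : ∀ {n} → Adj n → Subset n → Set
IsTwinsFreeClique {n} G X =
  IsClique G X × (∀ (u v : Fin n) → u ∈ X → v ∈ X → u ≢ v → ¬ TrueTwins G u v)

IsTwinsFreeCliqueNumber : ∀ {n} → Adj n → ℕ → Set
IsTwinsFreeCliqueNumber {n} G k =
  Σ (Subset n) (λ X → IsTwinsFreeClique G X × ∣ X ∣ ≡ k)
  × (∀ (X : Subset n) → IsTwinsFreeClique G X → ∣ X ∣ ≤ k)

-- Cartesian sum G ⊕ H on Fin (n * m) ≅ Fin n × Fin m (via remQuot):
-- (a,b) ~ (c,d)  iff  ac ∈ E(G) or bd ∈ E(H).
_⊕_ : ∀ {n m} → Adj n → Adj m → Adj (n * m)
_⊕_ {n} {m} G H x y with remQuot m x | remQuot m y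
... | (a , b) | (c , d) = G a c ∨ H b d

-- Take a maximum twins-free clique X of G and Y of H. Their product X × Y is a clique of G ⊕ H,
-- and it is twins-free: if (a,b) and (c,d) were true twins with a ≠ c, then testing against the
-- vertices (w,d) and (w,b) shows that a and c are true twins in G (here H must be loopless and
-- b, d adjacent or equal); if a = c, testing against the vertices (a,y) shows that b and d are
-- true twins in H. Hence ϖ(G ⊕ H) ≥ |X × Y| = ϖ(G) ϖ(H).
module Submission where

open import Defs
open import Data.Nat using (ℕ; _*_; _≤_; _+_; suc)
open import Data.Bool using (true; false; _∨_; _∧_)
open import Data.Bool.Properties using (∨-zeroʳ; ∨-identityʳ; ⇔→≡)
open import Data.Fin using (Fin; remQuot; combine; _≟_)
open import Data.Fin.Properties using (remQuot-combine; combine-remQuot; combine-injectiveˡ; combine-injectiveʳ)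
open import Data.Fin.Subset using (Subset; _∈_; ∣_∣; ⊥)
open import Data.Fin.Subset.Properties using (∣⊥∣≡0)
open import Data.Vec using ([]; _∷_; _++_; map; lookup; _⊛*_)
open import Data.Vec.Properties using (lookup-⊛*; lookup-map; map-id; []=⇒lookup; lookup⇒[]=)
open import Data.Product using (_×_; _,_; proj₁; proj₂)
open import Data.Sum using (_⊎_; inj₁; inj₂)
open import Function using (_∘_; mk⇔)
open import Function.Definitions using (Injective)
open import Relation.Binary.PropositionalEquality
open import Relation.Nullary using (¬_; yes; no; contradiction)
open import Relation.Nullary.Decidable using (⌊_⌋)

private
  variable
    n m : ℕ

∧-true⁻ : ∀ {x y} → x ∧ y ≡ true → x ≡ true × y ≡ true
∧-true⁻ {true} {true} refl = refl , refl

∨-trueʳ : ∀ x {y} → y ≡ true → x ∨ y ≡ true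
∨-trueʳ x refl = ∨-zeroʳ x

⌊≟⌋-injective : ∀ {k l} {f : Fin k → Fin l} → Injective _≡_ _≡_ f →
                (x y : Fin k) → ⌊ f x ≟ f y ⌋ ≡ ⌊ x ≟ y ⌋
⌊≟⌋-injective {f = f} f-inj x y with x ≟ y | f x ≟ f y
... | yes _ | yes _ = refl
... | no _ | no _ = refl
... | yes refl | no fx≢fx = contradiction refl fx≢fx
... | no x≢y | yes fx≡fy = contradiction (f-inj fx≡fy) x≢y

data Combined (n m : ℕ) : Fin (n * m) → Set where
  combined : (a : Fin n) (b : Fin m) → Combined n m (combine a b)

combined-view : (u : Fin (n * m)) → Combined n m u
combined-view {n} {m} u =
  subst (Combined n m) (combine-remQuot {n} m u)
        (combined (proj₁ (remQuot {n} m u)) (proj₂ (remQuot {n} m u)))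

_⊗_ : Subset n → Subset m → Subset (n * m)
p ⊗ q = map _∧_ p ⊛* q

lookup-⊗ : (p : Subset n) (q : Subset m) (a : Fin n) (b : Fin m) →
           lookup (p ⊗ q) (combine a b) ≡ lookup p a ∧ lookup q b
lookup-⊗ p q a b = trans (lookup-⊛* (map _∧_ p) q a b) (cong (λ f → f (lookup q b)) (lookup-map a _∧_ p))

∈-⊗⁻ : {p : Subset n} {q : Subset m} (a : Fin n) (b : Fin m) →
       combine a b ∈ p ⊗ q → a ∈ p × b ∈ q
∈-⊗⁻ {p = p} {q} a b ab∈p⊗q
  with pa , qb ← ∧-true⁻ (trans (sym (lookup-⊗ p q a b)) ([]=⇒lookup ab∈p⊗q))
  = lookup⇒[]= a p pa , lookup⇒[]= b q qb

∣p++q∣≡∣p∣+∣q∣ : (p : Subset n) (q : Subset m) → ∣ p ++ q ∣ ≡ ∣ p ∣ + ∣ q ∣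
∣p++q∣≡∣p∣+∣q∣ [] q = refl
∣p++q∣≡∣p∣+∣q∣ (true ∷ p) q = cong suc (∣p++q∣≡∣p∣+∣q∣ p q)
∣p++q∣≡∣p∣+∣q∣ (false ∷ p) q = ∣p++q∣≡∣p∣+∣q∣ p q

∣p⊗q∣≡∣p∣*∣q∣ : (p : Subset n) (q : Subset m) → ∣ p ⊗ q ∣ ≡ ∣ p ∣ * ∣ q ∣
∣p⊗q∣≡∣p∣*∣q∣ [] q = refl
∣p⊗q∣≡∣p∣*∣q∣ (true ∷ p) q = begin
  ∣ map (true ∧_) q ++ p ⊗ q ∣    ≡⟨ ∣p++q∣≡∣p∣+∣q∣ (map (true ∧_) q) (p ⊗ q) ⟩
  ∣ map (true ∧_) q ∣ + ∣ p ⊗ q ∣ ≡⟨ cong₂ _+_ (cong ∣_∣ (map-id q)) (∣p⊗q∣≡∣p∣*∣q∣ p q) ⟩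
  ∣ q ∣ + ∣ p ∣ * ∣ q ∣           ∎
  where open ≡-Reasoning
∣p⊗q∣≡∣p∣*∣q∣ {m = m} (false ∷ p) q = begin
  ∣ map (false ∧_) q ++ p ⊗ q ∣    ≡⟨ ∣p++q∣≡∣p∣+∣q∣ (map (false ∧_) q) (p ⊗ q) ⟩
  ∣ map (false ∧_) q ∣ + ∣ p ⊗ q ∣ ≡⟨ cong₂ _+_ (trans (cong ∣_∣ (map-false q)) (∣⊥∣≡0 m)) (∣p⊗q∣≡∣p∣*∣q∣ p q) ⟩
  ∣ p ∣ * ∣ q ∣                    ∎
  where
  open ≡-Reasoning
  map-false : ∀ {k} (r : Subset k) → map (false ∧_) r ≡ ⊥
  map-false [] = refl
  map-false (_ ∷ r) = cong (false ∷_) (map-false r)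

Loopless : Adj n → Set
Loopless {n} K = (u : Fin n) → K u u ≡ false

module _ (K : Adj n) where

  N[]-refl : (u : Fin n) → N[ K ] u u ≡ true
  N[]-refl u with u ≟ u
  ... | yes _ = refl
  ... | no u≢u = contradiction refl u≢u

  N[]-adj : {u w : Fin n} → K u w ≡ true → N[ K ] u w ≡ true
  N[]-adj = ∨-trueʳ _

  N[]-true⁻ : {u w : Fin n} → N[ K ] u w ≡ true → u ≡ w ⊎ K u w ≡ true
  N[]-true⁻ {u} {w} Nuw with u ≟ w
  ... | yes u≡w = inj₁ u≡w
  ... | no _ = inj₂ Nuw

  N[]-clique : {X : Subset n} → IsClique K X → {u w : Fin n} → u ∈ X → w ∈ X → N[ K ] u w ≡ true
  N[]-clique cX {u} {w} u∈X w∈X with u ≟ w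
  ... | yes _ = refl
  ... | no u≢w = cX u w u∈X w∈X u≢w

module _ (G : Adj n) (H : Adj m) where

  ⊕-combine : (a c : Fin n) (b d : Fin m) → (G ⊕ H) (combine a b) (combine c d) ≡ G a c ∨ H b d
  ⊕-combine a c b d =
    cong₂ (λ x y → G (proj₁ x) (proj₁ y) ∨ H (proj₂ x) (proj₂ y)) (remQuot-combine a b) (remQuot-combine c d)

  N[⊕]-sliceˡ : Loopless H → (a c : Fin n) (b : Fin m) →
                N[ G ⊕ H ] (combine a b) (combine c b) ≡ N[ G ] a c
  N[⊕]-sliceˡ H-loopless a c b = begin
    ⌊ combine a b ≟ combine c b ⌋ ∨ (G ⊕ H) (combine a b) (combine c b)
      ≡⟨ cong₂ _∨_ (⌊≟⌋-injective (λ {x} {y} → combine-injectiveˡ x b y b) a c) (⊕-combine a c b b) ⟩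
    ⌊ a ≟ c ⌋ ∨ (G a c ∨ H b b)
      ≡⟨ cong (λ h → ⌊ a ≟ c ⌋ ∨ (G a c ∨ h)) (H-loopless b) ⟩
    ⌊ a ≟ c ⌋ ∨ (G a c ∨ false)
      ≡⟨ cong (⌊ a ≟ c ⌋ ∨_) (∨-identityʳ (G a c)) ⟩
    N[ G ] a c ∎
    where open ≡-Reasoning

  N[⊕]-sliceʳ : Loopless G → (a : Fin n) (b d : Fin m) →
                N[ G ⊕ H ] (combine a b) (combine a d) ≡ N[ H ] b d
  N[⊕]-sliceʳ G-loopless a b d = begin
    ⌊ combine a b ≟ combine a d ⌋ ∨ (G ⊕ H) (combine a b) (combine a d)
      ≡⟨ cong₂ _∨_ (⌊≟⌋-injective (λ {x} {y} → combine-injectiveʳ a x a y) b d) (⊕-combine a a b d) ⟩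
    ⌊ b ≟ d ⌋ ∨ (G a a ∨ H b d)
      ≡⟨ cong (λ g → ⌊ b ≟ d ⌋ ∨ (g ∨ H b d)) (G-loopless a) ⟩
    N[ H ] b d ∎
    where open ≡-Reasoning

  N[⊕]-combine : {a c : Fin n} {b d : Fin m} → N[ G ] a c ≡ true → N[ H ] b d ≡ true →
                 N[ G ⊕ H ] (combine a b) (combine c d) ≡ true
  N[⊕]-combine {a} {c} {b} {d} Nac Nbd with N[]-true⁻ G Nac | N[]-true⁻ H Nbd
  ... | inj₁ refl | inj₁ refl = N[]-refl (G ⊕ H) (combine a b)
  ... | inj₂ Gac  | _         = N[]-adj (G ⊕ H) (trans (⊕-combine a c b d) (cong (_∨ H b d) Gac))
  ... | inj₁ _    | inj₂ Hbd  = N[]-adj (G ⊕ H) (trans (⊕-combine a c b d) (∨-trueʳ (G a c) Hbd))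

  TrueTwins-⊕⇒TrueTwinsˡ : Loopless H → {a c : Fin n} {b d : Fin m} →
                           N[ H ] b d ≡ true → N[ H ] d b ≡ true →
                           TrueTwins (G ⊕ H) (combine a b) (combine c d) → TrueTwins G a c
  TrueTwins-⊕⇒TrueTwinsˡ H-loopless Nbd Ndb twins w =
    ⇔→≡ (mk⇔ (transfer twins Nbd) (transfer (sym ∘ twins) Ndb))
    where
    transfer : {a c : Fin n} {b d : Fin m} → TrueTwins (G ⊕ H) (combine a b) (combine c d) →
               N[ H ] b d ≡ true → N[ G ] a w ≡ true → N[ G ] c w ≡ true
    transfer {a} {c} {b} {d} twins Nbd Naw = begin
      N[ G ] c w                                ≡⟨ N[⊕]-sliceˡ H-loopless c w d ⟨
      N[ G ⊕ H ] (combine c d) (combine w d)    ≡⟨ twins (combine w d) ⟨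
      N[ G ⊕ H ] (combine a b) (combine w d)    ≡⟨ N[⊕]-combine Naw Nbd ⟩
      true                                      ∎
      where open ≡-Reasoning

  TrueTwins-⊕⇒TrueTwinsʳ : Loopless G → {a : Fin n} {b d : Fin m} →
                           TrueTwins (G ⊕ H) (combine a b) (combine a d) → TrueTwins H b d
  TrueTwins-⊕⇒TrueTwinsʳ G-loopless twins y =
    ⇔→≡ (mk⇔ (transfer twins) (transfer (sym ∘ twins)))
    where
    transfer : {a : Fin n} {b d : Fin m} → TrueTwins (G ⊕ H) (combine a b) (combine a d) →
               N[ H ] b y ≡ true → N[ H ] d y ≡ true
    transfer {a} {b} {d} twins Nby = begin
      N[ H ] d y                                ≡⟨ N[⊕]-sliceʳ G-loopless a d y ⟨
      N[ G ⊕ H ] (combine a d) (combine a y)    ≡⟨ twins (combine a y) ⟨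
      N[ G ⊕ H ] (combine a b) (combine a y)    ≡⟨ N[⊕]-combine (N[]-refl G a) Nby ⟩
      true                                      ∎
      where open ≡-Reasoning

  ⊗-isClique : {X : Subset n} {Y : Subset m} → IsClique G X → IsClique H Y → IsClique (G ⊕ H) (X ⊗ Y)
  ⊗-isClique cX cY u v u∈ v∈ u≢v with combined-view {n} {m} u | combined-view {n} {m} v
  ... | combined a b | combined c d with ∈-⊗⁻ a b u∈ | ∈-⊗⁻ c d v∈ | a ≟ c
  ... | a∈X , b∈Y | c∈X , d∈Y | yes refl =
    trans (⊕-combine a a b d) (∨-trueʳ (G a a) (cY b d b∈Y d∈Y (u≢v ∘ cong (combine a))))
  ... | a∈X , b∈Y | c∈X , d∈Y | no a≢c =
    trans (⊕-combine a c b d) (cong (_∨ H b d) (cX a c a∈X c∈X a≢c))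

  ⊗-twinsFree : Loopless G → Loopless H → {X : Subset n} {Y : Subset m} →
                IsTwinsFreeClique G X → IsTwinsFreeClique H Y →
                ∀ u v → u ∈ X ⊗ Y → v ∈ X ⊗ Y → u ≢ v → ¬ TrueTwins (G ⊕ H) u v
  ⊗-twinsFree G-loopless H-loopless (_ , tfX) (cY , tfY) u v u∈ v∈ u≢v with combined-view {n} {m} u | combined-view {n} {m} v
  ... | combined a b | combined c d with ∈-⊗⁻ a b u∈ | ∈-⊗⁻ c d v∈ | a ≟ c
  ... | a∈X , b∈Y | c∈X , d∈Y | yes refl =
    tfY b d b∈Y d∈Y (u≢v ∘ cong (combine a)) ∘ TrueTwins-⊕⇒TrueTwinsʳ G-loopless
  ... | a∈X , b∈Y | c∈X , d∈Y | no a≢c =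
    tfX a c a∈X c∈X a≢c ∘ TrueTwins-⊕⇒TrueTwinsˡ H-loopless (N[]-clique H cY b∈Y d∈Y) (N[]-clique H cY d∈Y b∈Y)

lemma3 : ∀ (n m : ℕ) (G : Adj n) (H : Adj m) → IsSimple G → IsSimple H →
         ∀ (p q r : ℕ) → IsTwinsFreeCliqueNumber G p → IsTwinsFreeCliqueNumber H q →
         IsTwinsFreeCliqueNumber (G ⊕ H) r → p * q ≤ r
lemma3 n m G H (_ , G-loopless) (_ , H-loopless) p q r
       ((X , tfcX , ∣X∣≡p) , _) ((Y , tfcY , ∣Y∣≡q) , _) (_ , maximal) =
  subst (_≤ r) ∣X⊗Y∣≡p*q (maximal (X ⊗ Y) tfcX⊗Y)
  where
  tfcX⊗Y : IsTwinsFreeClique (G ⊕ H) (X ⊗ Y)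
  tfcX⊗Y = ⊗-isClique G H (proj₁ tfcX) (proj₁ tfcY) , ⊗-twinsFree G H G-loopless H-loopless tfcX tfcY
  ∣X⊗Y∣≡p*q : ∣ X ⊗ Y ∣ ≡ p * q
  ∣X⊗Y∣≡p*q = trans (∣p⊗q∣≡∣p∣*∣q∣ X Y) (cong₂ _*_ ∣X∣≡p ∣Y∣≡q)
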